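{- Let $\alpha$ be a composition with all parts $\ge2$ and $R_\alpha$ a ribbon with overlapping partition $p=(p_1,\dots,p_{\ell(\alpha)-1},0)$. For $1\le i\le\ell(\alpha)$ let $k_i\in\{1,\dots,\ell(\alpha)\}$ be the number of connected components of the ribbon obtained from $R_\alpha$ by deleting its $i-1$ largest rows. Then $p_i=\ell(\alpha)-(i-1)-k_i$ for $i=1,\dots,\ell(\alpha)-1$, $0\le p_{\ell(\alpha)-1}\le 1$, and $$p\subseteq(\ell(\alpha)-1,\dots,2,1,0)\subseteq\Big(\sum_{j=2}^{\ell(\alpha)}\alpha_j^+,\ \sum_{j=3}^{\ell(\alpha)}\alpha^+_j,\dots,\alpha^+_{\ell(\alpha)},0\Big)$$ (componentwise inequalities), and the set of distinct entries of $p$ is contained in $\{\ell(\alpha)-1,\dots,1,0\}$.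
   Context: A ribbon is a skew Young diagram (English convention) containing no $2\times2$ square. For a composition $\alpha$ with parts $\ge2$, $R_\alpha$ is a ribbon whose rows from top to bottom have lengths $\alpha_1,\dots,\alpha_{\ell(\alpha)}$, consecutive rows sharing at most one column and non-consecutive rows sharing none. $\alpha^+$ is the decreasing rearrangement of $\alpha$. Rows are ranked by length, ties between rows of equal length being broken so that a lower row counts as smaller; the "$i-1$ largest rows" are the rows of lengths $\alpha^+_1,\dots,\alpha^+_{i-1}$ in this ranking. The overlapping partition is $p=(p_1,\dots,p_{\ell(\alpha)-1},0)$ where $p_i$ is the number of columns of length two among the $\ell(\alpha)-i+1$ smallest rows of $R_\alpha$ in this ranking. -}

module Defs where

open import Data.Nat using (ℕ; zero; suc; _+_; _∸_; _≤_; _<_; _≟_; _<?_; _≤?_)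
open import Data.Nat.Properties using (≤-decTotalOrder)
open import Data.Fin using (Fin; toℕ; inject₁) renaming (suc to fsuc)
open import Data.Bool using (Bool; true; false; T)
open import Data.Product using (_×_; _,_)
open import Data.Sum using (_⊎_)
open import Data.List using (List; length; filter; reverse; drop; allFin)
open import Data.Nat.ListAction using (sum)
open import Data.List.Relation.Unary.All using (All)
open import Data.List.Relation.Unary.All using () renaming (all? to allL?)
open import Data.Vec using (Vec; toList; lookup)
open import Relation.Binary.PropositionalEquality using (_≡_)
open import Relation.Nullary using (Dec; ¬_; yes; no)
open import Relation.Nullary.Decidable using (_×-dec_; _⊎-dec_; ¬?; _→-dec_)
import Data.List.Sort as Sort

-- A ribbon R_α with ℓ(α) = n rows is determined by the row lengths
-- α : Vec ℕ n (row 0 = top row) together with, for every pair of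
-- consecutive rows (row e, row e+1), e : Fin (n-1), a bit  shares e
-- telling whether the two rows share a column (i.e. form a column of
-- length two).  Non-consecutive rows never share a column.
-- We work with n = suc m (a composition indexing p_1,…,p_ℓ has ℓ ≥ 1).

record Ribbon (m : ℕ) : Set where
  field
    rows   : Vec ℕ (suc m)        -- α_1,…,α_ℓ  (0-indexed)
    shares : Fin m → Bool

open Ribbon public

module _ {m : ℕ} (R : Ribbon m) where

  len : Fin (suc m) → ℕ
  len j = lookup (rows R) j

  -- Ranking of rows: row j' is larger than row j if it is longer, or
  -- equally long and higher (smaller index), i.e. lower rows count as smaller.
  Larger : Fin (suc m) → Fin (suc m) → Set
  Larger j' j = len j < len j' ⊎ (len j' ≡ len j × toℕ j' < toℕ j)

  larger? : ∀ j' j → Dec (Larger j' j)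
  larger? j' j = (len j <? len j') ⊎-dec ((len j' ≟ len j) ×-dec (toℕ j' <? toℕ j))

  nLarger : Fin (suc m) → ℕ
  nLarger j = length (filter (λ j' → larger? j' j) (allFin (suc m)))

  nSmaller : Fin (suc m) → ℕ
  nSmaller j = length (filter (λ j' → larger? j j') (allFin (suc m)))

  AmongLargest : ℕ → Fin (suc m) → Set
  AmongLargest k j = nLarger j < k

  AmongSmallest : ℕ → Fin (suc m) → Set
  AmongSmallest k j = nSmaller j < k

  twoColumnAmongSmallest? : (k : ℕ) → (e : Fin m) → Dec (T (shares R e) × AmongSmallest k (inject₁ e) × AmongSmallest k (fsuc e))
  twoColumnAmongSmallest? k e = T? (shares R e) ×-dec (nSmaller (inject₁ e) <? k) ×-dec (nSmaller (fsuc e) <? k)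
    where
    T? : (b : Bool) → Dec (T b)
    T? true  = yes _
    T? false = no (λ ())

  -- The overlapping partition p = (p_1,…,p_{ℓ-1},0), indexed as in the
  -- paper by i ∈ {1,…,ℓ}:  p_i = number of columns of length two among the
  -- ℓ-i+1 smallest rows for 1 ≤ i ≤ ℓ-1, and p_ℓ = 0.
  overlapping : ℕ → ℕ
  overlapping i with i <? suc m
  ... | yes _ = length (filter (twoColumnAmongSmallest? (suc m ∸ i + 1)) (allFin m))
  ... | no  _ = 0

  -- Kept rows are the vertices; two kept rows lie in the
  -- same component iff they are joined through a chain of cells, which
  -- (since only consecutive rows can share a column) means: every row
  -- between them is kept and every consecutive pair between them shares
  -- a column.
  Kept : ℕ → Fin (suc m) → Set
  Kept i j = ¬ AmongLargest (i ∸ 1) j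

  kept? : ∀ i j → Dec (Kept i j)
  kept? i j = ¬? (nLarger j <? (i ∸ 1))

  Joined : ℕ → Fin (suc m) → Fin (suc m) → Set
  Joined i a b =
    All (λ t → toℕ a ≤ toℕ t → toℕ t ≤ toℕ b → Kept i t) (allFin (suc m)) ×
    All (λ e → toℕ a ≤ toℕ e → toℕ e < toℕ b → T (shares R e)) (allFin m)

  joined? : ∀ i a b → Dec (Joined i a b)
  joined? i a b =
    allL? (λ t → (toℕ a ≤? toℕ t) →-dec ((toℕ t ≤? toℕ b) →-dec kept? i t)) (allFin (suc m))
    ×-dec allL? (λ e → (toℕ a ≤? toℕ e) →-dec ((toℕ e <? toℕ b) →-dec T? (shares R e))) (allFin m)
    where
    T? : (b : Bool) → Dec (T b)
    T? true  = yes _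
    T? false = no (λ ())

  -- a kept row is the topmost row of its component iff no kept row above
  -- it is joined to it; the number of components is the number of such rows
  TopOfComponent : ℕ → Fin (suc m) → Set
  TopOfComponent i b = Kept i b × All (λ a → toℕ a < toℕ b → ¬ Joined i a b) (allFin (suc m))

  topOfComponent? : ∀ i b → Dec (TopOfComponent i b)
  topOfComponent? i b = kept? i b ×-dec allL? (λ a → (toℕ a <? toℕ b) →-dec ¬? (joined? i a b)) (allFin (suc m))

  components : ℕ → ℕ
  components i = length (filter (topOfComponent? i) (allFin (suc m)))

  αplus : List ℕ
  αplus = reverse (Sort.sort ≤-decTotalOrder (toList (rows R)))

  tailSum : ℕ → ℕ
  tailSum i = sum (drop i αplus)

module Submission where

-- Fix 1 ≤ i ≤ ℓ and call a row *kept* if it is not among the i-1 largest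
-- rows.  The ribbon R_α is a path: row e and row e+1 are adjacent exactly
-- when they share a column.  Deleting rows leaves a disjoint union of
-- paths, so (Euler characteristic of a forest)
--     #components = #kept rows − #kept adjacent pairs.
-- Because the ranking of rows is a strict total order, the kept rows are
-- exactly the ℓ-i+1 smallest rows, so the kept adjacent pairs are the
-- columns of length two counted by p_i, and there are ℓ-(i-1) kept rows.
-- This gives p_i + k_i = ℓ-(i-1); with k_i ≥ 1 all inequalities on p
-- follow.  The comparison with the tail sums of α⁺ only uses α_j ≥ 2.

open import Defs
open import Data.Nat using (ℕ; zero; suc; _+_; _∸_; _≤_; _<_; z≤n; s≤s; _<?_)
open import Data.Nat.Properties
open import Data.Nat.ListAction using (sum)
open import Data.Fin using (Fin; toℕ; inject₁; fromℕ<; punchOut) renaming (zero to fzero; suc to fsuc)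
import Data.Fin.Properties as Finₚ
import Data.Fin.Permutation as Perm
open import Data.Bool using (Bool; true; false; T; _∧_; not)
open import Data.Bool.Properties using (∧-zeroʳ; ∧-identityʳ)
open import Data.Unit using (tt)
open import Data.Empty using (⊥-elim)
open import Data.Product using (_×_; _,_; proj₁; proj₂; ∃)
open import Data.Sum using (_⊎_; inj₁; inj₂)
open import Data.List using (List; length; filter; tabulate; allFin; drop)
import Data.List.Properties as Listₚ
import Data.List.Relation.Unary.All as All
import Data.List.Relation.Unary.All.Properties as Allₚ
import Data.Vec.Relation.Unary.All.Properties as VecAllₚ
open import Data.List.Relation.Binary.Permutation.Propositional using (_↭_; ↭-trans; ↭-sym)
import Data.List.Relation.Binary.Permutation.Propositional.Properties as Permₚ
import Data.List.Sort as Sort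
open import Data.Vec using (toList; lookup)
import Data.Vec.Properties as Vecₚ
import Algebra.Properties.CommutativeMonoid.Sum +-0-commutativeMonoid as Σ
open import Algebra.Properties.CommutativeSemigroup +-commutativeSemigroup using (interchange; xy∙z≈xz∙y)
open import Function using (_∘_; id; _⇔_; mk⇔; Equivalence)
open import Relation.Binary using (tri<; tri≈; tri>)
open import Relation.Binary.PropositionalEquality
open import Relation.Nullary using (Dec; ¬_; yes; no; does; contradiction)
open import Relation.Nullary.Decidable using (dec-true; dec-false; does-⇔; T?; _×-dec_; ¬?)

does-sound : ∀ {p} {P : Set p} (d : Dec P) → T (does d) → P
does-sound (yes p) _ = p

does-complete : ∀ {p} {P : Set p} (d : Dec P) → P → T (does d)
does-complete d p rewrite dec-true d p = tt

allFin⁻ : ∀ {p n} {P : Fin n → Set p} → All.All P (allFin n) → ∀ x → P x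
allFin⁻ = Allₚ.tabulate⁻ {f = id}

allFin⁺ : ∀ {p n} {P : Fin n → Set p} → (∀ x → P x) → All.All P (allFin n)
allFin⁺ = Allₚ.tabulate⁺ {f = id}

ind : Bool → ℕ
ind true  = 1
ind false = 0

count : ∀ n → (Fin n → Bool) → ℕ
count n b = Σ.sum (λ x → ind (b x))

length-filter : ∀ {a p} {A : Set a} {P : A → Set p} (P? : ∀ x → Dec (P x)) n (f : Fin n → A) →
                length (filter P? (tabulate f)) ≡ count n (λ x → does (P? (f x)))
length-filter P? zero    f = refl
length-filter P? (suc n) f with P? (f fzero)
... | yes _ = cong suc (length-filter P? n (f ∘ fsuc))
... | no  _ = length-filter P? n (f ∘ fsuc)

count-cong : ∀ n {b c : Fin n → Bool} → (∀ x → b x ≡ c x) → count n b ≡ count n c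
count-cong zero    eq = refl
count-cong (suc n) eq = cong₂ _+_ (cong ind (eq fzero)) (count-cong n (eq ∘ fsuc))

count-+ : ∀ n {a b c : Fin n → Bool} → (∀ x → ind (a x) + ind (b x) ≡ ind (c x)) →
          count n a + count n b ≡ count n c
count-+ zero    eq = refl
count-+ (suc n) {a} {b} eq = trans (interchange (ind (a fzero)) (count n (a ∘ fsuc)) (ind (b fzero)) (count n (b ∘ fsuc)))
                                   (cong₂ _+_ (eq fzero) (count-+ n (eq ∘ fsuc)))

count-all : ∀ n → count n (λ _ → true) ≡ n
count-all zero    = refl
count-all (suc n) = cong suc (count-all n)

count-none : ∀ n → count n (λ _ → false) ≡ 0
count-none zero    = refl
count-none (suc n) = count-none n

count-complement : ∀ n (b : Fin n → Bool) → count n b + count n (not ∘ b) ≡ n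
count-complement n b = trans (count-+ n {c = λ _ → true} one) (count-all n)
  where
  one : ∀ x → ind (b x) + ind (not (b x)) ≡ 1
  one x with b x
  ... | true  = refl
  ... | false = refl

ind-mono : ∀ {x y} → (T x → T y) → ind x ≤ ind y
ind-mono {false}         _ = z≤n
ind-mono {true} {true}   _ = ≤-refl
ind-mono {true} {false}  h = ⊥-elim (h tt)

count-mono : ∀ n {b c : Fin n → Bool} → (∀ x → T (b x) → T (c x)) → count n b ≤ count n c
count-mono zero    h = z≤n
count-mono (suc n) h = +-mono-≤ (ind-mono (h fzero)) (count-mono n (h ∘ fsuc))

count-strict : ∀ n {b c : Fin n → Bool} → (∀ x → T (b x) → T (c x)) →
               (y : Fin n) → ¬ T (b y) → T (c y) → count n b < count n c
count-strict (suc n) {b} {c} h fzero ¬by cy with b fzero | c fzero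
... | true  | _     = ⊥-elim (¬by tt)
... | false | false = ⊥-elim cy
... | false | true  = s≤s (count-mono n (h ∘ fsuc))
count-strict (suc n) h (fsuc y) ¬by cy = +-mono-≤-< (ind-mono (h fzero)) (count-strict n (h ∘ fsuc) y ¬by cy)

count-≤ : ∀ n (b : Fin n → Bool) → count n b ≤ n
count-≤ n b = subst (count n b ≤_) (count-all n) (count-mono n (λ _ _ → tt))

count-< : ∀ n (b : Fin n → Bool) (y : Fin n) → ¬ T (b y) → count n b < n
count-< n b y ¬by = subst (count n b <_) (count-all n) (count-strict n (λ _ _ → tt) y ¬by tt)

count-singleton : ∀ n (y : Fin n) → count n (λ x → does (x Finₚ.≟ y)) ≡ 1
count-singleton (suc n) fzero    = cong suc (trans (count-cong n (λ x → dec-false (fsuc x Finₚ.≟ fzero) λ ())) (count-none n))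
count-singleton (suc n) (fsuc y) = count-singleton n y

count-below : ∀ n k → k ≤ n → count n (λ v → does (toℕ v <? k)) ≡ k
count-below n       zero    _         = trans (count-cong n (λ v → dec-false (toℕ v <? 0) n≮0)) (count-none n)
count-below (suc n) (suc k) (s≤s k≤n) = cong suc (count-below n k k≤n)

-- An injective self-map of Fin n is a permutation (pigeonhole), so
-- reindexing along it does not change counts.
count-reindex : ∀ n (ρ : Fin n → Fin n) → (∀ {x y} → ρ x ≡ ρ y → x ≡ y) →
                (b : Fin n → Bool) → count n (b ∘ ρ) ≡ count n b
count-reindex zero    ρ ρ-inj b = refl
count-reindex (suc n) ρ ρ-inj b = sym (Σ.sum-permute (ind ∘ b) π)
  where
  surjective : ∀ v → ∃ λ x → ρ x ≡ v
  surjective v with Finₚ.any? (λ x → ρ x Finₚ.≟ v)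
  ... | yes hit  = hit
  ... | no  miss = contradiction (Finₚ.injective⇒≤ avoid-inj) 1+n≰n
    where
    avoid : Fin (suc n) → Fin n
    avoid x = punchOut {i = v} {j = ρ x} (λ eq → miss (x , sym eq))
    avoid-inj : ∀ {x y} → avoid x ≡ avoid y → x ≡ y
    avoid-inj {x} {y} eq = ρ-inj (Finₚ.punchOut-injective (λ e → miss (x , sym e)) (λ e → miss (y , sym e)) eq)
  π : Perm.Permutation (suc n) (suc n)
  π = Perm.permutation ρ (proj₁ ∘ surjective) (proj₂ ∘ surjective) (λ x → ρ-inj (proj₂ (surjective (ρ x))))

-- An injective map r : Fin n → ℕ with values below n takes every value
-- below n, so exactly k arguments have r-value below k.
count-injective-below : ∀ n (r : Fin n → ℕ) → (∀ x → r x < n) → (∀ {x y} → r x ≡ r y → x ≡ y) →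
                        ∀ k → k ≤ n → count n (λ x → does (r x <? k)) ≡ k
count-injective-below n r r<n r-inj k k≤n = begin
  count n (λ x → does (r x <? k))           ≡⟨ count-cong n (λ x → cong (λ t → does (t <? k)) (sym (Finₚ.toℕ-fromℕ< (r<n x)))) ⟩
  count n (below ∘ ρ)                       ≡⟨ count-reindex n ρ ρ-inj below ⟩
  count n below                             ≡⟨ count-below n k k≤n ⟩
  k                                         ∎
  where
  open ≡-Reasoning
  ρ : Fin n → Fin n
  ρ x = fromℕ< (r<n x)
  ρ-inj : ∀ {x y} → ρ x ≡ ρ y → x ≡ y
  ρ-inj {x} {y} eq = r-inj (trans (sym (Finₚ.toℕ-fromℕ< (r<n x))) (trans (cong toℕ eq) (Finₚ.toℕ-fromℕ< (r<n y))))
  below : Fin n → Bool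
  below v = does (toℕ v <? k)

-- With r + s = m and i ≤ m:  s < (m ∸ i) + 1  exactly when r ≮ i.
-- (An element with r larger and s smaller elements is among the m-i+1
-- smallest iff it is not among the i largest.)
complement-below : ∀ {r s m i} → r + s ≡ m → i ≤ m → (s < m ∸ i + 1) ⇔ (¬ r < i)
complement-below {r} {s} {m} {i} r+s≡m i≤m = mk⇔ to from
  where
  open ≤-Reasoning
  to : s < m ∸ i + 1 → ¬ r < i
  to lt = ≤⇒≯ (+-cancelʳ-≤ s i r (begin
    i + s  ≡⟨ +-comm i s ⟩
    s + i  ≤⟨ m≤o∸n⇒m+n≤o s i≤m (m<1+n⇒m≤n (subst (s <_) (+-comm (m ∸ i) 1) lt)) ⟩
    m      ≡⟨ sym r+s≡m ⟩
    r + s  ∎))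
  from : ¬ r < i → s < m ∸ i + 1
  from r≮i = subst (s <_) (+-comm 1 (m ∸ i)) (s≤s (m+n≤o⇒m≤o∸n s (begin
    s + i  ≤⟨ +-monoʳ-≤ s (≮⇒≥ r≮i) ⟩
    s + r  ≡⟨ +-comm s r ⟩
    r + s  ≡⟨ r+s≡m ⟩
    m      ∎)))

rearrange-sum : ∀ {p c d n} → d ≤ n → p + c ≡ n ∸ d → p ≡ n ∸ d ∸ c × p + d + c ≡ n
rearrange-sum {p} {c} {d} {n} d≤n eq =
  trans (sym (m+n∸n≡m p c)) (cong (_∸ c) eq) ,
  trans (xy∙z≈xz∙y p d c) (trans (cong (_+ d) eq) (m∸n+n≡m d≤n))

summand≤pred : ∀ {p c n} → 1 ≤ c → p + c ≡ n → p ≤ n ∸ 1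
summand≤pred {p} 1≤c eq = m+n≤o⇒m≤o∸n p (≤-trans (+-monoʳ-≤ p 1≤c) (≤-reflexive eq))

-- Restricting to a set of
-- kept vertices, each component is identified by its topmost vertex.

isTop : ∀ {m} → (Fin (suc m) → Bool) → (Fin m → Bool) → Fin (suc m) → Bool
isTop kept edge fzero    = kept fzero
isTop kept edge (fsuc e) = kept (fsuc e) ∧ not (edge e ∧ kept (inject₁ e))

keptEdge : ∀ {m} → (Fin (suc m) → Bool) → (Fin m → Bool) → Fin m → Bool
keptEdge kept edge e = edge e ∧ (kept (inject₁ e) ∧ kept (fsuc e))

-- Euler characteristic of a forest: components + edges = vertices.
-- Vertex 0 is a top iff kept; a kept vertex e+1 is either a top or the
-- lower end of the kept edge e, but not both.
tops+edges≡kept : ∀ m (kept : Fin (suc m) → Bool) (edge : Fin m → Bool) →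
                  count (suc m) (isTop kept edge) + count m (keptEdge kept edge) ≡ count (suc m) kept
tops+edges≡kept m kept edge =
  trans (+-assoc (ind (kept fzero)) _ _) (cong (ind (kept fzero) +_) (count-+ m split))
  where
  split : ∀ e → ind (isTop kept edge (fsuc e)) + ind (keptEdge kept edge e) ≡ ind (kept (fsuc e))
  split e with kept (fsuc e) | edge e | kept (inject₁ e)
  ... | true  | true  | true  = refl
  ... | true  | true  | false = refl
  ... | true  | false | _     = refl
  ... | false | true  | true  = refl
  ... | false | true  | false = refl
  ... | false | false | _     = refl

top-exists : ∀ m (kept : Fin (suc m) → Bool) (edge : Fin m → Bool) →
             1 ≤ count (suc m) kept → 1 ≤ count (suc m) (isTop kept edge)
top-exists zero    kept edge h = h
top-exists (suc m) kept edge h = by-first-vertex (kept fzero) refl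
  where
  -- a kept vertex 0 is a top; otherwise the tops are those of the path without vertex 0
  by-first-vertex : ∀ b → kept fzero ≡ b → 1 ≤ count (suc (suc m)) (isTop kept edge)
  by-first-vertex true  kept₀ = ≤-trans (≤-reflexive (cong ind (sym kept₀))) (m≤m+n _ _)
  by-first-vertex false kept₀ =
    subst (1 ≤_) (trans (count-cong (suc m) shift) (cong (λ z → ind z + count (suc m) (isTop kept edge ∘ fsuc)) (sym kept₀)))
          (top-exists m (kept ∘ fsuc) (edge ∘ fsuc) (subst (λ z → 1 ≤ ind z + count (suc m) (kept ∘ fsuc)) kept₀ h))
    where
    shift : ∀ x → isTop (kept ∘ fsuc) (edge ∘ fsuc) x ≡ isTop kept edge (fsuc x)
    shift fzero rewrite kept₀ =
      sym (trans (cong (λ z → kept (fsuc fzero) ∧ not z) (∧-zeroʳ (edge fzero))) (∧-identityʳ (kept (fsuc fzero))))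
    shift (fsuc e) = refl

-- The ranking of the rows of a ribbon.
-- `Larger` is a strict total order on rows, so the number of rows larger
-- than a given row is its rank 0,1,…,ℓ-1, and ranks are all distinct.

module _ {m : ℕ} (R : Ribbon m) where

  Larger-irrefl : ∀ j → ¬ Larger R j j
  Larger-irrefl j (inj₁ p)       = <-irrefl refl p
  Larger-irrefl j (inj₂ (_ , q)) = <-irrefl refl q

  Larger-asym : ∀ a b → Larger R a b → ¬ Larger R b a
  Larger-asym a b (inj₁ p)       (inj₁ q)       = <-asym p q
  Larger-asym a b (inj₁ p)       (inj₂ (e , _)) = <-irrefl e p
  Larger-asym a b (inj₂ (e , _)) (inj₁ q)       = <-irrefl e q
  Larger-asym a b (inj₂ (_ , p)) (inj₂ (_ , q)) = <-asym p q

  Larger-trans : ∀ a b c → Larger R a b → Larger R b c → Larger R a c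
  Larger-trans a b c (inj₁ p)       (inj₁ q)        = inj₁ (<-trans q p)
  Larger-trans a b c (inj₁ p)       (inj₂ (e , _))  = inj₁ (subst (_< len R a) e p)
  Larger-trans a b c (inj₂ (e , _)) (inj₁ q)        = inj₁ (subst (len R c <_) (sym e) q)
  Larger-trans a b c (inj₂ (e , p)) (inj₂ (e′ , q)) = inj₂ (trans e e′ , <-trans p q)

  -- Ties in length are broken by position, so distinct rows are comparable.
  Larger-connex : ∀ a b → a ≢ b → Larger R a b ⊎ Larger R b a
  Larger-connex a b a≢b with <-cmp (len R a) (len R b)
  ... | tri< lt _ _ = inj₂ (inj₁ lt)
  ... | tri> _ _ gt = inj₁ (inj₁ gt)
  ... | tri≈ _ eq _ with <-cmp (toℕ a) (toℕ b)
  ...   | tri< lt _ _ = inj₁ (inj₂ (eq , lt))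
  ...   | tri> _ _ gt = inj₂ (inj₂ (sym eq , gt))
  ...   | tri≈ _ e _  = ⊥-elim (a≢b (Finₚ.toℕ-injective e))

  larger : Fin (suc m) → Fin (suc m) → Bool
  larger a b = does (larger? R a b)

  nLarger-count : ∀ j → nLarger R j ≡ count (suc m) (λ j′ → larger j′ j)
  nLarger-count j = length-filter (λ j′ → larger? R j′ j) (suc m) id

  nSmaller-count : ∀ j → nSmaller R j ≡ count (suc m) (λ j′ → larger j j′)
  nSmaller-count j = length-filter (λ j′ → larger? R j j′) (suc m) id

  -- Every other row is either larger or smaller than j, so the two counts
  -- add up to ℓ - 1.
  nLarger+nSmaller : ∀ j → nLarger R j + nSmaller R j ≡ m
  nLarger+nSmaller j = suc-injective (begin
    suc (nLarger R j + nSmaller R j)              ≡⟨ cong suc (cong₂ _+_ (nLarger-count j) (nSmaller-count j)) ⟩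
    suc (count (suc m) above + count (suc m) below) ≡⟨ +-comm 1 _ ⟩
    count (suc m) above + count (suc m) below + 1 ≡⟨ cong₂ _+_ (count-+ (suc m) {a = above} {b = below} trichotomy) (sym (count-singleton (suc m) j)) ⟩
    count (suc m) (not ∘ same) + count (suc m) same ≡⟨ +-comm (count (suc m) (not ∘ same)) _ ⟩
    count (suc m) same + count (suc m) (not ∘ same) ≡⟨ count-complement (suc m) same ⟩
    suc m                                         ∎)
    where
    open ≡-Reasoning
    above below same : Fin (suc m) → Bool
    above j′ = larger j′ j
    below j′ = larger j j′
    same  j′ = does (j′ Finₚ.≟ j)
    trichotomy : ∀ j′ → ind (above j′) + ind (below j′) ≡ ind (not (same j′))
    trichotomy j′ with j′ Finₚ.≟ j
    ... | yes refl rewrite dec-false (larger? R j j) (Larger-irrefl j) = refl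
    ... | no j′≢j with Larger-connex j′ j j′≢j
    ...   | inj₁ p rewrite dec-true (larger? R j′ j) p | dec-false (larger? R j j′) (Larger-asym j′ j p) = refl
    ...   | inj₂ p rewrite dec-true (larger? R j j′) p | dec-false (larger? R j′ j) (Larger-asym j j′ p) = refl

  nLarger-strict : ∀ a b → Larger R a b → nLarger R a < nLarger R b
  nLarger-strict a b a>b = subst₂ _<_ (sym (nLarger-count a)) (sym (nLarger-count b))
    (count-strict (suc m) above-a⇒above-b a
      (λ t → Larger-irrefl a (does-sound (larger? R a a) t)) (does-complete (larger? R a b) a>b))
    where
    above-a⇒above-b : ∀ x → T (larger x a) → T (larger x b)
    above-a⇒above-b x t = does-complete (larger? R x b) (Larger-trans x a b (does-sound (larger? R x a) t) a>b)

  -- Distinct rows are comparable, hence have distinct ranks.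
  nLarger-injective : ∀ {a b} → nLarger R a ≡ nLarger R b → a ≡ b
  nLarger-injective {a} {b} eq with a Finₚ.≟ b
  ... | yes a≡b = a≡b
  ... | no  a≢b with Larger-connex a b a≢b
  ...   | inj₁ p = ⊥-elim (<-irrefl eq (nLarger-strict a b p))
  ...   | inj₂ p = ⊥-elim (<-irrefl (sym eq) (nLarger-strict b a p))

  -- A row is not larger than itself, so at most ℓ-1 rows are larger.
  nLarger<ℓ : ∀ j → nLarger R j < suc m
  nLarger<ℓ j = subst (_< suc m) (sym (nLarger-count j))
    (count-< (suc m) (λ j′ → larger j′ j) j (λ t → Larger-irrefl j (does-sound (larger? R j j) t)))

  keptRow : ℕ → Fin (suc m) → Bool
  keptRow i j = does (kept? R i j)

  -- Ranks are distinct and below ℓ, so exactly i-1 rows are deleted.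
  count-kept : ∀ i → i ∸ 1 ≤ suc m → count (suc m) (keptRow i) ≡ suc m ∸ (i ∸ 1)
  count-kept i i-1≤ℓ = begin
    count (suc m) (keptRow i)                                   ≡⟨ sym (m+n∸m≡n (count (suc m) deleted) _) ⟩
    count (suc m) deleted + count (suc m) (keptRow i) ∸ count (suc m) deleted
                                                                ≡⟨ cong₂ _∸_ (count-complement (suc m) deleted) deleted-count ⟩
    suc m ∸ (i ∸ 1)                                             ∎
    where
    open ≡-Reasoning
    deleted : Fin (suc m) → Bool
    deleted j = does (nLarger R j <? (i ∸ 1))
    deleted-count : count (suc m) deleted ≡ i ∸ 1
    deleted-count = count-injective-below (suc m) (nLarger R) nLarger<ℓ nLarger-injective (i ∸ 1) i-1≤ℓ

  smallest⇔kept : ∀ i → 1 ≤ i → i ≤ suc m → ∀ j → AmongSmallest R (suc m ∸ i + 1) j ⇔ Kept R i j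
  smallest⇔kept (suc i) _ (s≤s i≤m) j = complement-below (nLarger+nSmaller j) i≤m

  joined-above : ∀ i a e → toℕ a < toℕ (fsuc e) → Joined R i a (fsuc e) → T (shares R e) × Kept R i (inject₁ e)
  joined-above i a e (s≤s a≤e) (rowsKept , columnsShared) =
    allFin⁻ columnsShared e a≤e ≤-refl ,
    allFin⁻ rowsKept (inject₁ e) (subst (toℕ a ≤_) (sym (Finₚ.toℕ-inject₁ e)) a≤e)
                                 (subst (_≤ suc (toℕ e)) (sym (Finₚ.toℕ-inject₁ e)) (n≤1+n (toℕ e)))

  joined-adjacent : ∀ i e → T (shares R e) → Kept R i (inject₁ e) → Kept R i (fsuc e) → Joined R i (inject₁ e) (fsuc e)
  joined-adjacent i e shared keptₑ keptₑ₊₁ = allFin⁺ between-kept , allFin⁺ between-shared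
    where
    between-kept : ∀ t → toℕ (inject₁ e) ≤ toℕ t → toℕ t ≤ suc (toℕ e) → Kept R i t
    between-kept t e≤t t≤e+1 with m≤n⇒m<n∨m≡n t≤e+1
    ... | inj₂ t≡e+1     = subst (Kept R i) (Finₚ.toℕ-injective {j = t} (sym t≡e+1)) keptₑ₊₁
    ... | inj₁ (s≤s t≤e) = subst (Kept R i) (Finₚ.toℕ-injective {j = t}
                             (≤-antisym e≤t (subst (toℕ t ≤_) (sym (Finₚ.toℕ-inject₁ e)) t≤e))) keptₑ
    between-shared : ∀ e′ → toℕ (inject₁ e) ≤ toℕ e′ → toℕ e′ < suc (toℕ e) → T (shares R e′)
    between-shared e′ e≤e′ (s≤s e′≤e) = subst (T ∘ shares R)
      (Finₚ.toℕ-injective (≤-antisym (subst (_≤ toℕ e′) (Finₚ.toℕ-inject₁ e) e≤e′) e′≤e)) shared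

  top⇔isTop : ∀ i b → does (topOfComponent? R i b) ≡ isTop (keptRow i) (shares R) b
  top⇔isTop i fzero = does-⇔ (mk⇔ proj₁ (λ k → k , allFin⁺ (λ _ a<0 → ⊥-elim (n≮0 a<0))))
                             (topOfComponent? R i fzero) (kept? R i fzero)
  top⇔isTop i (fsuc e) = does-⇔ (mk⇔ to from) (topOfComponent? R i (fsuc e))
                                (kept? R i (fsuc e) ×-dec ¬? (T? (shares R e) ×-dec kept? R i (inject₁ e)))
    where
    to : TopOfComponent R i (fsuc e) → Kept R i (fsuc e) × ¬ (T (shares R e) × Kept R i (inject₁ e))
    to (k , noneAbove) = k , λ (shared , keptₑ) →
      allFin⁻ noneAbove (inject₁ e) (subst (_< suc (toℕ e)) (sym (Finₚ.toℕ-inject₁ e)) ≤-refl)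
              (joined-adjacent i e shared keptₑ k)
    from : Kept R i (fsuc e) × ¬ (T (shares R e) × Kept R i (inject₁ e)) → TopOfComponent R i (fsuc e)
    from (k , unattached) = k , allFin⁺ (λ a a<e+1 joined → unattached (joined-above i a e a<e+1 joined))

  components-count : ∀ i → components R i ≡ count (suc m) (isTop (keptRow i) (shares R))
  components-count i = trans (length-filter (topOfComponent? R i) (suc m) id) (count-cong (suc m) (top⇔isTop i))

  overlapping-below : ∀ i → i < suc m →
                      overlapping R i ≡ length (filter (twoColumnAmongSmallest? R (suc m ∸ i + 1)) (allFin m))
  overlapping-below i i<ℓ with i <? suc m
  ... | yes _   = refl
  ... | no  i≮ℓ = contradiction i<ℓ i≮ℓ

  overlapping-last : overlapping R (suc m) ≡ 0
  overlapping-last with suc m <? suc m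
  ... | yes ℓ<ℓ = contradiction ℓ<ℓ (<-irrefl refl)
  ... | no  _   = refl

  overlapping-count : ∀ i → 1 ≤ i → i ≤ m → overlapping R i ≡ count m (keptEdge (keptRow i) (shares R))
  overlapping-count i 1≤i i≤m = begin
    overlapping R i                                               ≡⟨ overlapping-below i (s≤s i≤m) ⟩
    length (filter (twoColumnAmongSmallest? R k) (allFin m))      ≡⟨ length-filter (twoColumnAmongSmallest? R k) m id ⟩
    count m (λ e → does (twoColumnAmongSmallest? R k e))          ≡⟨ count-cong m same-columns ⟩
    count m (keptEdge (keptRow i) (shares R))                     ∎
    where
    open ≡-Reasoning
    k : ℕ
    k = suc m ∸ i + 1
    small⇔kept : ∀ j → AmongSmallest R k j ⇔ Kept R i j
    small⇔kept = smallest⇔kept i 1≤i (m≤n⇒m≤1+n i≤m)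
    same-columns : ∀ e → does (twoColumnAmongSmallest? R k e) ≡ keptEdge (keptRow i) (shares R) e
    same-columns e = does-⇔
      (mk⇔ (λ (t , a , b) → t , Equivalence.to (small⇔kept (inject₁ e)) a , Equivalence.to (small⇔kept (fsuc e)) b)
           (λ (t , a , b) → t , Equivalence.from (small⇔kept (inject₁ e)) a , Equivalence.from (small⇔kept (fsuc e)) b))
      (twoColumnAmongSmallest? R k e) (T? (shares R e) ×-dec (kept? R i (inject₁ e) ×-dec kept? R i (fsuc e)))

  overlapping+components : ∀ i → 1 ≤ i → i ≤ m → overlapping R i + components R i ≡ suc m ∸ (i ∸ 1)
  overlapping+components i 1≤i i≤m = begin
    overlapping R i + components R i     ≡⟨ cong₂ _+_ (overlapping-count i 1≤i i≤m) (components-count i) ⟩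
    count m edges + count (suc m) tops   ≡⟨ +-comm (count m edges) _ ⟩
    count (suc m) tops + count m edges   ≡⟨ tops+edges≡kept m (keptRow i) (shares R) ⟩
    count (suc m) (keptRow i)            ≡⟨ count-kept i (≤-trans (m∸n≤m i 1) (m≤n⇒m≤1+n i≤m)) ⟩
    suc m ∸ (i ∸ 1)                      ∎
    where
    open ≡-Reasoning
    edges : Fin m → Bool
    edges = keptEdge (keptRow i) (shares R)
    tops : Fin (suc m) → Bool
    tops = isTop (keptRow i) (shares R)

  -- 1 ≤ k_i ≤ ℓ: at least one row survives, and components are counted by rows.
  components-bounds : ∀ i → 1 ≤ i → i ≤ suc m → 1 ≤ components R i × components R i ≤ suc m
  components-bounds (suc i) _ (s≤s i≤m) =
    subst (1 ≤_) (sym (components-count (suc i)))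
      (top-exists m (keptRow (suc i)) (shares R)
        (subst (1 ≤_) (sym (count-kept (suc i) (m≤n⇒m≤1+n i≤m))) (m<n⇒0<n∸m (s≤s i≤m)))) ,
    subst (_≤ suc m) (sym (components-count (suc i))) (count-≤ (suc m) (isTop (keptRow (suc i)) (shares R)))

  -- p_i ≤ ℓ - i, since k_i ≥ 1 (and p_ℓ = 0).
  overlapping-bound : ∀ i → 1 ≤ i → i ≤ suc m → overlapping R i ≤ suc m ∸ i
  overlapping-bound (suc i) 1≤i (s≤s i≤m) with m≤n⇒m<n∨m≡n i≤m
  ... | inj₂ refl = ≤-reflexive (trans overlapping-last (sym (n∸n≡0 (suc m))))
  ... | inj₁ i<m  = subst (overlapping R (suc i) ≤_) ℓ-i-1≡ℓ-[i+1]
      (summand≤pred (proj₁ (components-bounds (suc i) 1≤i (s≤s i≤m))) (overlapping+components (suc i) 1≤i i<m))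
    where
    ℓ-i-1≡ℓ-[i+1] : suc m ∸ i ∸ 1 ≡ suc m ∸ suc i
    ℓ-i-1≡ℓ-[i+1] = trans (∸-+-assoc (suc m) i 1) (cong (suc m ∸_) (+-comm i 1))

length≤sum : ∀ {xs : List ℕ} → All.All (1 ≤_) xs → length xs ≤ sum xs
length≤sum All.[]         = z≤n
length≤sum (px All.∷ pxs) = +-mono-≤ px (length≤sum pxs)

-- α⁺ is a rearrangement of α, so if all parts are positive then
-- Σ_{j>i} α⁺_j ≥ ℓ - i, the number of its summands.
tailSum-bound : ∀ {m} (R : Ribbon m) → (∀ j → 1 ≤ lookup (rows R) j) → ∀ i → suc m ∸ i ≤ tailSum R i
tailSum-bound {m} R positive i = subst (_≤ tailSum R i) length-tail (length≤sum (Allₚ.drop⁺ i αplus-positive))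
  where
  αplus↭α : αplus R ↭ toList (rows R)
  αplus↭α = ↭-trans (Permₚ.↭-reverse _) (Sort.sort-↭ ≤-decTotalOrder (toList (rows R)))
  αplus-positive : All.All (1 ≤_) (αplus R)
  αplus-positive = Permₚ.All-resp-↭ (↭-sym αplus↭α) (VecAllₚ.toList⁺ (VecAllₚ.lookup⁻ positive))
  length-tail : length (drop i (αplus R)) ≡ suc m ∸ i
  length-tail = trans (Listₚ.length-drop i (αplus R))
                      (cong (_∸ i) (trans (Permₚ.↭-length αplus↭α) (Vecₚ.length-toList (rows R))))

proposition3p2 :
    (m : ℕ) (R : Ribbon m) →
    ((j : Fin (suc m)) → 2 ≤ lookup (rows R) j) →
    ((i : ℕ) → 1 ≤ i → i ≤ suc m → 1 ≤ components R i × components R i ≤ suc m)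
    × ((i : ℕ) → 1 ≤ i → i ≤ m → overlapping R i ≡ suc m ∸ (i ∸ 1) ∸ components R i
                                  × overlapping R i + (i ∸ 1) + components R i ≡ suc m)
    × (1 ≤ m → overlapping R m ≤ 1)
    × ((i : ℕ) → 1 ≤ i → i ≤ suc m → overlapping R i ≤ suc m ∸ i × suc m ∸ i ≤ tailSum R i)
    × ((i : ℕ) → 1 ≤ i → i ≤ suc m → overlapping R i ≤ m)
proposition3p2 m R parts≥2 =
  components-bounds R ,
  (λ i 1≤i i≤m → rearrange-sum (≤-trans (m∸n≤m i 1) (m≤n⇒m≤1+n i≤m)) (overlapping+components R i 1≤i i≤m)) ,
  (λ 1≤m → subst (overlapping R m ≤_) (m+n∸n≡m 1 m) (overlapping-bound R m 1≤m (n≤1+n m))) ,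
  (λ i 1≤i i≤ℓ → overlapping-bound R i 1≤i i≤ℓ , tailSum-bound R (≤-trans (s≤s z≤n) ∘ parts≥2) i) ,
  (λ i 1≤i i≤ℓ → ≤-trans (overlapping-bound R i 1≤i i≤ℓ) (ℓ-i≤ℓ-1 i 1≤i))
  where
  ℓ-i≤ℓ-1 : ∀ i → 1 ≤ i → suc m ∸ i ≤ m
  ℓ-i≤ℓ-1 (suc i) _ = m∸n≤m m i
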